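{- Let $m\geq 2$ and $p\geq 2$. The vertex set of the circulant graph $C(m,p)$ can be partitioned into the $p$ sets $M_i=\{i+rp : 0\leq r\leq m-1\}$, $i=0,\dots,p-1$, each of size $m$, and each $M_i$ is a stable set (independent set) and a module of $C(m,p)$.
   Context: For integers $m\geq 1$, $p\geq 2$ with $n=mp\geq 3$, $C(m,p)$ is the graph with vertex set $\{0,1,\dots,n-1\}$ in which $i$ and $j$ are adjacent iff $j-i \bmod n$ belongs to $A=\{p-1+rp,\ p+1+rp : 0\leq r\leq m-1\}\subset\mathbb{Z}_n$. A module of a graph $G=(V,E)$ is a subset $M\subseteq V$ such that every $y\in V\setminus M$ is adjacent either to all vertices of $M$ or to none of them. -}

module Defs where

open import Data.Nat using (ℕ; zero; suc; _+_; _*_; _∸_; _<_; _≤_; NonZero)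
open import Data.Nat.DivMod using (_%_)
open import Data.Fin using (Fin; toℕ)
open import Data.Product using (Σ; ∃; _×_; _,_)
open import Data.Sum using (_⊎_)
open import Relation.Binary.PropositionalEquality using (_≡_)
open import Relation.Nullary using (¬_)

InA : (m p : ℕ) → .{{_ : NonZero (m * p)}} → ℕ → Set
InA m p d = Σ ℕ λ r → r < m ×
  ((d ≡ (p ∸ 1 + r * p) % (m * p)) ⊎ (d ≡ (p + 1 + r * p) % (m * p)))

Adj : (m p : ℕ) → .{{_ : NonZero (m * p)}} → Fin (m * p) → Fin (m * p) → Set
Adj m p i j = InA m p ((toℕ j + (m * p ∸ toℕ i)) % (m * p))

InM : (m p : ℕ) → ℕ → Fin (m * p) → Set
InM m p i v = Σ ℕ λ r → r < m × toℕ v ≡ i + r * p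

Stable : (m p : ℕ) → .{{_ : NonZero (m * p)}} → (Fin (m * p) → Set) → Set
Stable m p S = ∀ x y → S x → S y → ¬ Adj m p x y

IsModule : (m p : ℕ) → .{{_ : NonZero (m * p)}} → (Fin (m * p) → Set) → Set
IsModule m p S = ∀ y → ¬ S y →
  (∀ x → S x → Adj m p y x) ⊎ (∀ x → S x → ¬ Adj m p y x)

-- Adjacency is a congruence condition modulo p: every element of A is ≡ ±1
-- (mod p), and conversely every d < n with d ≡ ±1 (mod p) is some p ∓ 1 + rp
-- reduced mod n.  Two vertices of one class M_i differ by a multiple of p, so
-- M_i is stable; and for y ∉ M_i the difference x - y ≡ i - y (mod p) is the
-- same for all x ∈ M_i, so y sees either all of M_i or none of it.
module Submission where

open import Defs
open import Data.Nat using (ℕ; zero; suc; _+_; _*_; _∸_; _<_; _≤_; NonZero; >-nonZero; z<s; pred; _≟_)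
open import Data.Nat.Properties
open import Data.Nat.DivMod
open import Data.Nat.Divisibility using (n∣m*n)
open import Data.Fin using (Fin; toℕ; fromℕ<)
open import Data.Fin.Properties using (toℕ-injective; toℕ<n; fromℕ<-toℕ; toℕ-fromℕ<)
open import Data.Product using (Σ; _×_; _,_; proj₁)
open import Data.Sum using (_⊎_; inj₁; inj₂)
open import Function.Bundles using (_↔_; mk↔ₛ′)
open import Relation.Nullary using (¬_; yes; no)
open import Relation.Nullary.Decidable using (_⊎-dec_)
open import Relation.Unary using (Decidable)
open import Relation.Binary.PropositionalEquality

module _ (m p : ℕ) (1<p : 1 < p) .{{_ : NonZero (m * p)}} where

  private
    n = m * p

    instance
      p≢0 : NonZero p
      p≢0 = >-nonZero (<-trans z<s 1<p)
      m≢0 : NonZero m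
      m≢0 = m*n≢0⇒m≢0 m

    pred<m : pred m < m
    pred<m = subst (pred m <_) (suc-pred m) ≤-refl

  -- The set A reduced modulo p.
  Jump : ℕ → Set
  Jump d = d ≡ 1 ⊎ d ≡ p ∸ 1

  jump? : Decidable Jump
  jump? d = (d ≟ 1) ⊎-dec (d ≟ p ∸ 1)

  ¬Jump-0 : ¬ Jump 0
  ¬Jump-0 (inj₁ ())
  ¬Jump-0 (inj₂ 0≡p∸1) = m>n⇒m∸n≢0 1<p (sym 0≡p∸1)

  %n%p≡%p : ∀ e → e % n % p ≡ e % p
  %n%p≡%p e = m∣n⇒o%n%m≡o%m p n e (n∣m*n m)

  p+1+rp≡1+[1+r]p : ∀ r → p + 1 + r * p ≡ 1 + suc r * p
  p+1+rp≡1+[1+r]p r = cong (_+ r * p) (+-comm p 1)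

  InA⇒Jump : ∀ e → InA m p (e % n) → Jump (e % p)
  InA⇒Jump e (r , _ , inj₁ eq) = inj₂ (begin
    e % p                         ≡⟨ sym (%n%p≡%p e) ⟩
    e % n % p                     ≡⟨ cong (_% p) eq ⟩
    (p ∸ 1 + r * p) % n % p       ≡⟨ %n%p≡%p (p ∸ 1 + r * p) ⟩
    (p ∸ 1 + r * p) % p           ≡⟨ [m+kn]%n≡m%n (p ∸ 1) r p ⟩
    (p ∸ 1) % p                   ≡⟨ m<n⇒m%n≡m (∸-monoʳ-< z<s (<⇒≤ 1<p)) ⟩
    p ∸ 1                         ∎)
    where open ≡-Reasoning
  InA⇒Jump e (r , _ , inj₂ eq) = inj₁ (begin
    e % p                         ≡⟨ sym (%n%p≡%p e) ⟩
    e % n % p                     ≡⟨ cong (_% p) eq ⟩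
    (p + 1 + r * p) % n % p       ≡⟨ %n%p≡%p (p + 1 + r * p) ⟩
    (p + 1 + r * p) % p           ≡⟨ cong (_% p) (p+1+rp≡1+[1+r]p r) ⟩
    (1 + suc r * p) % p           ≡⟨ [m+kn]%n≡m%n 1 (suc r) p ⟩
    1 % p                         ≡⟨ m<n⇒m%n≡m 1<p ⟩
    1                             ∎)
    where open ≡-Reasoning

  -- Write d = (d mod p) + q p with q < m.  For d ≡ 1 (mod p) the witness is
  -- p + 1 + (q - 1) p, except for d = 1, reached by wrapping around:
  -- p + 1 + (m - 1) p = 1 + n.
  Jump⇒InA : ∀ e → Jump (e % p) → InA m p (e % n)
  Jump⇒InA e jump = fromDivMod jump (m≡m%n+[m/n]*n d p) (m<n*o⇒m/o<n {d} {m} {p} d<n)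
    where
    d = e % n
    d<n : d < n
    d<n = m%n<n e n
    d%p≡e%p : d % p ≡ e % p
    d%p≡e%p = %n%p≡%p e
    d≡d%n : d ≡ d % n
    d≡d%n = sym (m<n⇒m%n≡m d<n)
    fromDivMod : Jump (e % p) → d ≡ d % p + d / p * p → d / p < m → InA m p d
    fromDivMod (inj₂ e%p≡p∸1) d≡d%p+qp q<m = d / p , q<m , inj₁ (begin
      d                             ≡⟨ d≡d%n ⟩
      d % n                         ≡⟨ cong (_% n) d≡d%p+qp ⟩
      (d % p + d / p * p) % n       ≡⟨ cong (λ z → (z + d / p * p) % n) (trans d%p≡e%p e%p≡p∸1) ⟩
      (p ∸ 1 + d / p * p) % n       ∎)
      where open ≡-Reasoning
    fromDivMod (inj₁ e%p≡1) d≡d%p+qp q<m with d / p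
    ... | suc q = q , <-trans (n<1+n q) q<m , inj₂ (begin
      d                             ≡⟨ d≡d%n ⟩
      d % n                         ≡⟨ cong (_% n) d≡d%p+qp ⟩
      (d % p + suc q * p) % n       ≡⟨ cong (λ z → (z + suc q * p) % n) (trans d%p≡e%p e%p≡1) ⟩
      (1 + suc q * p) % n           ≡⟨ cong (_% n) (sym (p+1+rp≡1+[1+r]p q)) ⟩
      (p + 1 + q * p) % n           ∎)
      where open ≡-Reasoning
    ... | zero = pred m , pred<m , inj₂ (begin
      d                             ≡⟨ trans d≡d%p+qp (trans (+-identityʳ _) (trans d%p≡e%p e%p≡1)) ⟩
      1                             ≡⟨ sym (m<n⇒m%n≡m (≤-trans 1<p (m≤n*m p m))) ⟩
      1 % n                         ≡⟨ sym ([m+n]%n≡m%n 1 n) ⟩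
      (1 + n) % n                   ≡⟨ cong (λ z → (1 + z * p) % n) (sym (suc-pred m)) ⟩
      (1 + suc (pred m) * p) % n    ≡⟨ cong (_% n) (sym (p+1+rp≡1+[1+r]p (pred m))) ⟩
      (p + 1 + pred m * p) % n      ∎)
      where open ≡-Reasoning

  InM⇒+%p : ∀ {i} {x : Fin n} c → InM m p i x → (toℕ x + c) % p ≡ (i + c) % p
  InM⇒+%p {i} {x} c (r , _ , x≡i+rp) = begin
    (toℕ x + c) % p       ≡⟨ cong (λ z → (z + c) % p) x≡i+rp ⟩
    (i + r * p + c) % p   ≡⟨ cong (_% p) (+-assoc i (r * p) c) ⟩
    (i + (r * p + c)) % p ≡⟨ cong (λ z → (i + z) % p) (+-comm (r * p) c) ⟩
    (i + (c + r * p)) % p ≡⟨ cong (_% p) (sym (+-assoc i c (r * p))) ⟩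
    (i + c + r * p) % p   ≡⟨ [m+kn]%n≡m%n (i + c) r p ⟩
    (i + c) % p           ∎
    where open ≡-Reasoning

  InM-%p : (v : Fin n) → InM m p (toℕ v % p) v
  InM-%p v = toℕ v / p , m<n*o⇒m/o<n {toℕ v} {m} {p} (toℕ<n v) , m≡m%n+[m/n]*n (toℕ v) p

  InM-unique : ∀ {i} {v : Fin n} → i < p → InM m p i v → i ≡ toℕ v % p
  InM-unique {i} i<p (r , _ , v≡i+rp) = sym (begin
    toℕ _ % p       ≡⟨ cong (_% p) v≡i+rp ⟩
    (i + r * p) % p ≡⟨ [m+kn]%n≡m%n i r p ⟩
    i % p           ≡⟨ m<n⇒m%n≡m i<p ⟩
    i               ∎)
    where open ≡-Reasoning

  InM-irrelevant : ∀ {i} {v : Fin n} (a b : InM m p i v) → a ≡ b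
  InM-irrelevant {i} (r , r<m , v≡i+rp) (r′ , r′<m , v≡i+r′p)
    with *-cancelʳ-≡ r r′ p (+-cancelˡ-≡ i _ _ (trans (sym v≡i+rp) v≡i+r′p))
  ... | refl = cong₂ (λ r<m v≡i+rp → r , r<m , v≡i+rp) (<-irrelevant _ _) (≡-irrelevant _ _)

  M-≡ : ∀ {i} {v w : Fin n} {a : InM m p i v} {b : InM m p i w} →
        v ≡ w → _≡_ {A = Σ (Fin n) (InM m p i)} (v , a) (w , b)
  M-≡ {a = a} {b} refl = cong (_ ,_) (InM-irrelevant a b)

  Fin↔M : ∀ {i} → i < p → Fin m ↔ Σ (Fin n) (InM m p i)
  Fin↔M {i} i<p = mk↔ₛ′ to from to∘from from∘to
    where
    i+rp<n : ∀ {r} → r < m → i + r * p < n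
    i+rp<n {r} r<m = ≤-trans (+-monoˡ-< (r * p) i<p) (*-monoˡ-≤ p r<m)
    to : Fin m → Σ (Fin n) (InM m p i)
    to r = fromℕ< (i+rp<n (toℕ<n r)) , toℕ r , toℕ<n r , toℕ-fromℕ< (i+rp<n (toℕ<n r))
    from : Σ (Fin n) (InM m p i) → Fin m
    from (_ , _ , r<m , _) = fromℕ< r<m
    to∘from : ∀ v → to (from v) ≡ v
    to∘from (v , r , r<m , v≡i+rp) = M-≡ (toℕ-injective (begin
      toℕ (proj₁ (to (fromℕ< r<m))) ≡⟨ toℕ-fromℕ< _ ⟩
      i + toℕ (fromℕ< r<m) * p      ≡⟨ cong (λ z → i + z * p) (toℕ-fromℕ< r<m) ⟩
      i + r * p                     ≡⟨ sym v≡i+rp ⟩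
      toℕ v                         ∎))
      where open ≡-Reasoning
    from∘to : ∀ r → from (to r) ≡ r
    from∘to r = fromℕ<-toℕ r _

  M-partition : (v : Fin n) → Σ ℕ λ i → i < p × InM m p i v × (∀ j → j < p → InM m p j v → j ≡ i)
  M-partition v = toℕ v % p , m%n<n (toℕ v) p , InM-%p v , λ _ j<p → InM-unique j<p

  M-stable : ∀ i → Stable m p (InM m p i)
  M-stable i x y x∈M y∈M x~y = ¬Jump-0 (subst Jump diff%p≡0 (InA⇒Jump _ x~y))
    where
    open ≡-Reasoning
    diff%p≡0 : (toℕ y + (n ∸ toℕ x)) % p ≡ 0
    diff%p≡0 = begin
      (toℕ y + (n ∸ toℕ x)) % p ≡⟨ InM⇒+%p _ y∈M ⟩
      (i + (n ∸ toℕ x)) % p     ≡⟨ sym (InM⇒+%p _ x∈M) ⟩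
      (toℕ x + (n ∸ toℕ x)) % p ≡⟨ cong (_% p) (m+[n∸m]≡n (<⇒≤ (toℕ<n x))) ⟩
      n % p                     ≡⟨ m*n%n≡0 m p ⟩
      0                         ∎

  M-module : ∀ i → IsModule m p (InM m p i)
  M-module i y _ with jump? ((i + (n ∸ toℕ y)) % p)
  ... | yes jump = inj₁ λ x x∈M → Jump⇒InA _ (subst Jump (sym (InM⇒+%p _ x∈M)) jump)
  ... | no ¬jump = inj₂ λ x x∈M y~x → ¬jump (subst Jump (InM⇒+%p _ x∈M) (InA⇒Jump _ y~x))

mainTheorem4 : (m p : ℕ) → 2 ≤ m → 2 ≤ p → .{{_ : NonZero (m * p)}} →
    ((v : Fin (m * p)) → Σ ℕ (λ i → i < p × InM m p i v × ((j : ℕ) → j < p → InM m p j v → j ≡ i)))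
    × ((i : ℕ) → i < p →
    (Fin m ↔ Σ (Fin (m * p)) (InM m p i))
    × Stable m p (InM m p i)
    × IsModule m p (InM m p i))
mainTheorem4 m p _ 1<p =
    M-partition m p 1<p
  , λ i i<p → Fin↔M m p 1<p i<p , M-stable m p 1<p i , M-module m p 1<p i
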